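{- Let $\kappa\le\lambda$ be infinite cardinals. If $(f,g)$ is a Chu transform from a Chu space $\langle X,r,A\rangle$ to a Chu space $\langle Y,s,B\rangle$ with $f$ surjective, and $\langle X,r,A\rangle$ is $\langle\kappa,\lambda\rangle$-compact, then $\langle Y,s,B\rangle$ is $\langle\kappa,\lambda\rangle$-compact.
   Context: A Chu space is a triple $\langle X,r,A\rangle$ with $r\subseteq X\times A$. A Chu transform from $\langle X,r,A\rangle$ to $\langle Y,s,B\rangle$ is a pair $f\colon X\to Y$, $g\colon B\to A$ such that $\langle x,g(b)\rangle\in r\iff\langle f(x),b\rangle\in s$ for all $x\in X$, $b\in B$. For infinite cardinals $\kappa\le\lambda$, a Chu space $\langle X,r,A\rangle$ is $\langle\kappa,\lambda\rangle$-compact if it satisfies the two-sorted infinitary sentence \[ \forall\langle v^\mathsf{s}_\alpha:\alpha<\lambda\rangle\Bigl(\exists v^\mathsf{p}\bigwedge_{\alpha<\lambda}\lnot R(v^\mathsf{p},v^\mathsf{s}_\alpha)\ \lor\bigvee_{Z\in[\lambda]^{<\kappa}}\forall v^\mathsf{p}\bigvee_{\alpha\in Z}R(v^\mathsf{p},v^\mathsf{s}_\alpha)\Bigr), \] i.e. for every sequence $\langle a_\alpha:\alpha<\lambda\rangle$ of elements of $A$, either there is $x\in X$ with $\langle x,a_\alpha\rangle\notin r$ for all $\alpha<\lambda$, or there is $Z\subseteq\lambda$ with $|Z|<\kappa$ such that every $x\in X$ satisfies $\langle x,a_\alpha\rangle\in r$ for some $\alpha\in Z$. (Here $v^\mathsf{p}$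 ranges over points, $v^\mathsf{s}$ over states, $R$ is interpreted as $r$.) -}

module Defs where

open import Level using (Level; _⊔_) renaming (suc to lsuc)
open import Data.Nat using (ℕ)
open import Data.Product using (Σ; Σ-syntax; ∃; _×_; _,_)
open import Data.Sum using (_⊎_)
open import Relation.Nullary using (¬_)
open import Relation.Unary using (Pred)
open import Function.Bundles using (_↣_; _⇔_)

-- Cardinals are represented by (index) types; a set of cardinality κ is a type K.
-- κ is infinite: ℕ injects into K.
Infinite : ∀ {ℓ} → Set ℓ → Set ℓ
Infinite K = ℕ ↣ K

_≤ᶜ_ : ∀ {ℓ} → Set ℓ → Set ℓ → Set ℓ
K ≤ᶜ L = K ↣ L

_<ᶜ_ : ∀ {ℓ} → Set ℓ → Set ℓ → Set ℓ
Z <ᶜ K = (Z ↣ K) × ¬ (K ↣ Z)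

record Chu (ℓ : Level) : Set (lsuc ℓ) where
  field
    Pt : Set ℓ
    St : Set ℓ
    R  : Pt → St → Set ℓ
open Chu public

ChuTransform : ∀ {ℓ} → Chu ℓ → Chu ℓ → Set ℓ
ChuTransform C D =
  Σ[ f ∈ (Pt C → Pt D) ] Σ[ g ∈ (St D → St C) ]
    (∀ (x : Pt C) (b : St D) → (R C x (g b) ⇔ R D (f x) b))

Compact : ∀ {ℓ} → (K L : Set ℓ) → Chu ℓ → Set (lsuc ℓ)
Compact {ℓ} K L C =
  ∀ (a : L → St C) →
    (Σ[ x ∈ Pt C ] (∀ (α : L) → ¬ R C x (a α)))
    ⊎ (Σ[ Z ∈ Pred L ℓ ] ((Σ L Z <ᶜ K) × (∀ (x : Pt C) → Σ[ α ∈ L ] (Z α × R C x (a α)))))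

{-# OPTIONS --safe #-}
module Submission where

open import Defs
open import Level using (Level)
open import Data.Product using (Σ-syntax; _×_; proj₁; _,_)
open import Data.Sum using (inj₁; inj₂)
open import Function using (_∘_)
open import Function.Bundles using (Equivalence)
open import Function.Definitions using (Surjective)
open import Relation.Binary.PropositionalEquality using (_≡_; refl; subst)
open import Relation.Nullary using (¬_)
open import Relation.Unary using (Pred)

-- A family b of states of D is pulled back along g to the family g ∘ b of C.
-- A point x of C avoiding g ∘ b gives the point f x avoiding b; a small Z covering
-- g ∘ b in C also covers b in D, because every point of D is some f x.

Avoids : ∀ {ℓ} {L : Set ℓ} (C : Chu ℓ) → Pt C → (L → St C) → Set ℓ
Avoids C x a = ∀ α → ¬ R C x (a α)

Covers : ∀ {ℓ} {L : Set ℓ} (C : Chu ℓ) → Pred L ℓ → (L → St C) → Set ℓ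
Covers {L = L} C Z a = ∀ x → Σ[ α ∈ L ] (Z α × R C x (a α))

avoids-transform : ∀ {ℓ} {C D : Chu ℓ} ((f , g , _) : ChuTransform C D)
  {L : Set ℓ} {b : L → St D} {x} →
  Avoids C x (g ∘ b) → Avoids D (f x) b
avoids-transform (_ , _ , r⇔s) {b = b} {x} x-avoids α = x-avoids α ∘ Equivalence.from (r⇔s x (b α))

covers-surjective-transform : ∀ {ℓ} {C D : Chu ℓ} ((f , g , _) : ChuTransform C D) →
  Surjective _≡_ _≡_ f → ∀ {L : Set ℓ} {b : L → St D} {Z} → Covers C Z (g ∘ b) → Covers D Z b
covers-surjective-transform {D = D} (_ , _ , r⇔s) surj {b = b} Z-covers y with surj y
... | x , fx≡y with Z-covers x
... | α , α∈Z , rxgbα =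
  α , α∈Z , subst (λ w → R D w (b α)) (fx≡y refl) (Equivalence.to (r⇔s x (b α)) rxgbα)

compact-surjective-transform : ∀ {ℓ} {K L : Set ℓ} (C D : Chu ℓ) (t : ChuTransform C D) →
  Surjective _≡_ _≡_ (proj₁ t) → Compact K L C → Compact K L D
compact-surjective-transform C D t@(f , g , _) surj C-compact b with C-compact (g ∘ b)
... | inj₁ (x , x-avoids) = inj₁ (f x , avoids-transform {C = C} {D} t x-avoids)
... | inj₂ (Z , Z<K , Z-covers) =
  inj₂ (Z , Z<K , covers-surjective-transform {C = C} {D} t surj Z-covers)

corollary4p3 : ∀ {ℓ : Level} (K L : Set ℓ) → Infinite K → Infinite L → K ≤ᶜ L →
    (C D : Chu ℓ) (t : ChuTransform C D) → Surjective _≡_ _≡_ (proj₁ t) →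
    Compact K L C → Compact K L D
corollary4p3 K L _ _ _ C D = compact-surjective-transform C D
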